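{- Let $G=\langle V,E,r\rangle$ be a trimmed and flat rooted directed graph with $n=n(G)$ nodes and $m=m(G)$ edges that admits fewer than $m^4$ arborescences. Let $A,B$ be two edge-disjoint arborescences of $G$ such that for every edge $(u,v)\in E$, $v$ is not an ancestor of $u$ in at least one of $A,B$, and let $C=E\setminus(A\cup B)$. Then $|C|=\mathcal{O}(n)$.
   Context: Parallel edges allowed, no loops. An arborescence is a set of $n-1$ edges such that every node is reachable from $r$ using only them, viewed as a tree rooted at $r$. An edge is nontrivial if it is in some but not all arborescences; trimmed means every edge is nontrivial; flat means at most two parallel copies of each edge. -}

module Defs where

open import Data.Nat using (ℕ; _∸_; _<_; _≤_)
open import Data.Fin using (Fin)
open import Data.Fin.Subset using (Subset; _∈_; _∉_; ∣_∣)
open import Data.Product using (Σ; _×_; ∃)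
open import Data.List using (List; length)
import Data.List.Membership.Propositional as L
open import Data.List.Relation.Unary.Unique.Propositional using (Unique)
open import Relation.Binary.PropositionalEquality using (_≡_; _≢_)
open import Relation.Nullary using (¬_)
open import Data.Empty using (⊥)

record RootedGraph (n m : ℕ) : Set where
  field
    src    : Fin m → Fin n
    tgt    : Fin m → Fin n
    root   : Fin n
    noLoop : ∀ e → src e ≢ tgt e

module _ {n m : ℕ} (G : RootedGraph n m) where
  open RootedGraph G

  data Path (S : Subset m) (u : Fin n) : Fin n → Set where
    here : Path S u u
    step : ∀ {w} e → Path S u w → e ∈ S → src e ≡ w → Path S u (tgt e)

  IsArborescence : Subset m → Set
  IsArborescence S = (∣ S ∣ ≡ n ∸ 1) × (∀ v → Path S root v)

  -- In an arborescence A (a tree rooted at root), u is an ancestor of v iff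
  -- v is reachable from u using edges of A (u lies on the root-to-v path).
  Ancestor : Subset m → Fin n → Fin n → Set
  Ancestor A u v = Path A u v

  Nontrivial : Fin m → Set
  Nontrivial e = (∃ λ A → IsArborescence A × e ∈ A)
               × (∃ λ A → IsArborescence A × e ∉ A)

  Trimmed : Set
  Trimmed = ∀ e → Nontrivial e

  -- at most two parallel copies of each edge: no three distinct edges
  -- with the same source and target.
  Flat : Set
  Flat = ∀ e₁ e₂ e₃ → src e₁ ≡ src e₂ → tgt e₁ ≡ tgt e₂
                    → src e₁ ≡ src e₃ → tgt e₁ ≡ tgt e₃
                    → e₁ ≢ e₂ → e₁ ≢ e₃ → e₂ ≢ e₃ → ⊥

  FewerArborescencesThan : ℕ → Set
  FewerArborescencesThan k =
    Σ (List (Subset m)) λ L →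
      Unique L × (∀ A → IsArborescence A → A L.∈ L) × (∀ A → A L.∈ L → IsArborescence A)
      × length L < k

{-# OPTIONS --safe #-}
-- Every edge is forward in one of four depth-first orders. For an arborescence T, order the nodes
-- lexicographically by their root paths, once comparing siblings by increasing and once by decreasing
-- index; an edge (u, v) whose head v is not an ancestor of u in T goes forward in one of the two. The
-- forward edges of such an order form an acyclic graph in which the root has no in-edge and every other
-- node has at least one (its parent edge in T), so choosing one in-edge per non-root node independently
-- gives ∏ indeg(v) distinct arborescences of G. Flatness bounds every in-degree by 2n and m by 2n²; more
-- than 33n forward edges would therefore give at least (1 + 2n)⁸ ≥ m⁴ arborescences. Hence m ≤ 4 · 33n,
-- and in particular |C| ≤ 132n.
module Submission where

open import Level using (Level; 0ℓ)
open import Function using (_∘_; id; flip)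
open import Data.Empty using (⊥)
open import Data.Unit using (tt)
open import Data.Bool using (true; false; if_then_else_)
open import Data.Product using (Σ; _×_; _,_; proj₁; proj₂; ∃)
open import Data.Sum using (_⊎_; inj₁; inj₂)
open import Data.Nat using (ℕ; zero; suc; _+_; _*_; _^_; _∸_; _≤_; _<_; z≤n; s≤s; _≤?_; >-nonZero⁻¹)
open import Data.Nat.Properties hiding (_≟_)
open import Data.Nat.ListAction using (sum; product)
open import Data.Fin using (Fin; zero; suc; _≟_)
import Data.Fin as Fin
open import Data.Fin.Properties using (nonZeroIndex)
import Data.Fin.Properties as Finₚ
open import Data.Fin.Induction using (spo-wellFounded)
open import Data.Fin.Subset using (Subset; _∈_; _∉_; ∣_∣; ⁅_⁆; _∪_; ∁) renaming (⊥ to ∅)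
open import Data.Fin.Subset.Properties
  using (_∈?_; ∉⊥; x∈⁅x⁆; x∈⁅y⁆⇒x≡y; x∈p∪q⁺; x∈p∪q⁻; ⊆-antisym; ∣p∣≤n)
open import Data.Vec using ([]; _∷_)
open import Data.List as List
  using (List; []; _∷_; _++_; _∷ʳ_; length; filter; allFin; map; foldr; reverse; cartesianProduct)
open import Data.List.Properties
  using (length-++-sucʳ; length-++; length-map; map-cong; map-∘; map-tabulate; unfold-reverse)
open import Data.List.Membership.Propositional using () renaming (_∈_ to _∈ₗ_; _∉_ to _∉ₗ_)
open import Data.List.Membership.Propositional.Properties
  using (∈-filter⁺; ∈-filter⁻; ∈-allFin; ∈-∃++; ∈-++⁻; ∈-++⁺ˡ; ∈-++⁺ʳ; ∈-map⁻
        ; ∈-cartesianProduct⁻)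
open import Data.List.Relation.Unary.Any using (here; there)
open import Data.List.Relation.Unary.Any.Properties using (reverse⁺; reverse⁻)
open import Data.List.Relation.Unary.All as All using (All; []; _∷_)
open import Data.List.Relation.Unary.All.Properties using (all-filter) renaming (map⁺ to All-map⁺)
open import Data.List.Relation.Unary.AllPairs using ([]; _∷_)
open import Data.List.Relation.Unary.Unique.Propositional using (Unique)
import Data.List.Relation.Unary.Unique.Propositional.Properties as Unique
open import Data.List.Relation.Binary.Lex.Strict as Lex using (Lex-<; halt; this; next)
open import Relation.Nullary using (¬_; yes; no; does; contradiction; _×-dec_; ¬?)
open import Relation.Unary using (Pred; Decidable; U)
open import Relation.Unary.Properties using (_∩?_; _∪?_; ∁?; U?)
open import Relation.Binary using (Rel; Trichotomous; tri<; tri≈; tri>; IsStrictTotalOrder)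
open import Relation.Binary.PropositionalEquality
import Relation.Binary.Construct.On as On
import Relation.Binary.Construct.Flip.EqAndOrd as Flip
open import Induction.WellFounded using (WellFounded; Acc; acc; module Subrelation)
open import Algebra.Properties.CommutativeMonoid.Sum +-0-commutativeMonoid
  using (sum-syntax; sum-cong-≗; ∑-distrib-+; ∑-comm; sum-replicate-zero)

open import Defs

private
  variable
    ℓ : Level
    A : Set

∑-const : ∀ k c → ∑[ i < k ] c ≡ k * c
∑-const zero    c = refl
∑-const (suc k) c = cong (c +_) (∑-const k c)

sum-tabulate : ∀ {k} (f : Fin k → ℕ) → sum (List.tabulate f) ≡ ∑[ i < k ] f i
sum-tabulate {zero}  f = refl
sum-tabulate {suc k} f = cong (f zero +_) (sum-tabulate (f ∘ suc))

∑-mono-≤ : ∀ {k} {f g : Fin k → ℕ} → (∀ i → f i ≤ g i) → ∑[ i < k ] f i ≤ ∑[ i < k ] g i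
∑-mono-≤ {zero}  f≤g = z≤n
∑-mono-≤ {suc k} f≤g = +-mono-≤ (f≤g zero) (∑-mono-≤ (f≤g ∘ suc))

∑-mono-< : ∀ {k} {f g : Fin k → ℕ} → (∀ i → f i ≤ g i) → ∀ j → f j < g j →
           ∑[ i < k ] f i < ∑[ i < k ] g i
∑-mono-< f≤g zero    fj<gj = +-mono-<-≤ fj<gj (∑-mono-≤ (f≤g ∘ suc))
∑-mono-< f≤g (suc j) fj<gj = +-mono-≤-< (f≤g zero) (∑-mono-< (f≤g ∘ suc) j fj<gj)

∑-tight : ∀ {k} {f g : Fin k → ℕ} → (∀ i → f i ≤ g i) → ∑[ i < k ] g i ≤ ∑[ i < k ] f i →
          ∀ i → g i ≤ f i
∑-tight {f = f} {g} f≤g ∑g≤∑f i with g i ≤? f i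
... | yes gi≤fi = gi≤fi
... | no  gi≰fi = contradiction (∑-mono-< f≤g i (≰⇒> gi≰fi)) (≤⇒≯ ∑g≤∑f)

unique-⊆⇒length≤ : {xs ys : List A} → Unique xs → (∀ {x} → x ∈ₗ xs → x ∈ₗ ys) →
                   length xs ≤ length ys
unique-⊆⇒length≤ {xs = []}     _            _     = z≤n
unique-⊆⇒length≤ {xs = x ∷ xs} (x∉xs ∷ uxs) xs⊆ys with ∈-∃++ (xs⊆ys (here refl))
... | ys₁ , ys₂ , refl = subst (suc (length xs) ≤_) (sym (length-++-sucʳ ys₁ x ys₂))
                           (s≤s (unique-⊆⇒length≤ uxs xs⊆ys₁ys₂))
  where
  xs⊆ys₁ys₂ : ∀ {y} → y ∈ₗ xs → y ∈ₗ ys₁ ++ ys₂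
  xs⊆ys₁ys₂ {y} y∈xs with ∈-++⁻ ys₁ (xs⊆ys (there y∈xs))
  ... | inj₁ y∈ys₁         = ∈-++⁺ˡ y∈ys₁
  ... | inj₂ (here refl)   = contradiction refl (All.lookup x∉xs y∈xs)
  ... | inj₂ (there y∈ys₂) = ∈-++⁺ʳ ys₁ y∈ys₂

unique-map⁺ : {B : Set} {f : A → B} {xs : List A} →
              (∀ {x y} → x ∈ₗ xs → y ∈ₗ xs → f x ≡ f y → x ≡ y) → Unique xs → Unique (map f xs)
unique-map⁺ {xs = []}     _   []           = []
unique-map⁺ {xs = x ∷ xs} inj (x∉xs ∷ uxs) =
  All-map⁺ (All.tabulate λ y∈xs fx≡fy → All.lookup x∉xs y∈xs (inj (here refl) (there y∈xs) fx≡fy))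
  ∷ unique-map⁺ (λ x∈xs y∈xs → inj (there x∈xs) (there y∈xs)) uxs

length-cartesianProduct : {B : Set} (xs : List A) (ys : List B) →
                          length (cartesianProduct xs ys) ≡ length xs * length ys
length-cartesianProduct []       ys = refl
length-cartesianProduct (x ∷ xs) ys = trans (length-++ (map (x ,_) ys))
  (cong₂ _+_ (length-map (x ,_) ys) (length-cartesianProduct xs ys))

⁅⁆∪-injective : ∀ {k} {e e′ : Fin k} {X X′ : Subset k} → e ∉ X′ → e′ ∉ X →
                ⁅ e ⁆ ∪ X ≡ ⁅ e′ ⁆ ∪ X′ → e ≡ e′ × X ≡ X′
⁅⁆∪-injective {e = e} {e′} {X} {X′} e∉X′ e′∉X eq =
  e≡e′ , ⊆-antisym (X⊆ e′∉X eq) (X⊆ e∉X′ (sym eq))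
  where
  e≡e′ : e ≡ e′
  e≡e′ with x∈p∪q⁻ ⁅ e′ ⁆ X′ (subst (e ∈_) eq (x∈p∪q⁺ (inj₁ (x∈⁅x⁆ e))))
  ... | inj₁ e∈⁅e′⁆ = x∈⁅y⁆⇒x≡y e′ e∈⁅e′⁆
  ... | inj₂ e∈X′   = contradiction e∈X′ e∉X′
  X⊆ : ∀ {d d′ Y Y′} → d′ ∉ Y → ⁅ d ⁆ ∪ Y ≡ ⁅ d′ ⁆ ∪ Y′ → ∀ {x} → x ∈ Y → x ∈ Y′
  X⊆ {d′ = d′} {Y} {Y′} d′∉Y eq {x} x∈Y
    with x∈p∪q⁻ ⁅ d′ ⁆ Y′ (subst (x ∈_) eq (x∈p∪q⁺ (inj₂ x∈Y)))
  ... | inj₁ x∈⁅d′⁆ = contradiction (subst (_∈ Y) (x∈⁅y⁆⇒x≡y d′ x∈⁅d′⁆) x∈Y) d′∉Y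
  ... | inj₂ x∈Y′   = x∈Y′

-- Counting decidable predicates on Fin k

module _ {k : ℕ} {P : Pred (Fin k) ℓ} (P? : Decidable P) where

  χ : Fin k → ℕ
  χ x = if does (P? x) then 1 else 0

  χ≤1 : ∀ x → χ x ≤ 1
  χ≤1 x with does (P? x)
  ... | true  = ≤-refl
  ... | false = z≤n

  count : ℕ
  count = ∑[ i < k ] χ i

  witnesses : List (Fin k)
  witnesses = filter P? (allFin k)

  length-witnesses : length witnesses ≡ count
  length-witnesses = length-filter-tabulate id
    where
    length-filter-tabulate : ∀ {j} (f : Fin j → Fin k) → length (filter P? (List.tabulate f)) ≡ ∑[ i < j ] χ (f i)
    length-filter-tabulate {zero}  f = refl
    length-filter-tabulate {suc j} f with does (P? (f zero))
    ... | true  = cong suc (length-filter-tabulate (f ∘ suc))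
    ... | false = length-filter-tabulate (f ∘ suc)

  witnesses-unique : Unique witnesses
  witnesses-unique = Unique.filter⁺ P? (Unique.allFin⁺ k)

  ∈-witnesses : ∀ {x} → P x → x ∈ₗ witnesses
  ∈-witnesses {x} Px = ∈-filter⁺ P? (∈-allFin x) Px

  ∈-witnesses⁻ : ∀ {x} → x ∈ₗ witnesses → P x
  ∈-witnesses⁻ x∈ = proj₂ (∈-filter⁻ P? {xs = allFin k} x∈)

  count>0 : ∀ {x} → P x → 0 < count
  count>0 Px = subst (0 <_) length-witnesses
    (unique-⊆⇒length≤ ([] ∷ []) λ { (here refl) → ∈-witnesses Px })

  count≥2 : ∀ {x y} → P x → P y → x ≢ y → 2 ≤ count
  count≥2 Px Py x≢y = subst (2 ≤_) length-witnesses
    (unique-⊆⇒length≤ ((x≢y ∷ []) ∷ [] ∷ [])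
      λ { (here refl) → ∈-witnesses Px ; (there (here refl)) → ∈-witnesses Py })

  count≤1 : (∀ {x y} → P x → P y → x ≡ y) → count ≤ 1
  count≤1 P-unique = subst (_≤ 1) length-witnesses (length≤1 witnesses-unique (all-filter P? (allFin k)))
    where
    length≤1 : ∀ {xs} → Unique xs → All P xs → length xs ≤ 1
    length≤1 {[]}        _               _             = z≤n
    length≤1 {_ ∷ []}    _               _             = s≤s z≤n
    length≤1 {_ ∷ _ ∷ _} ((x≢y ∷ _) ∷ _) (Px ∷ Py ∷ _) = contradiction (P-unique Px Py) x≢y

  count≤2 : (∀ {x y z} → P x → P y → P z → x ≢ y → x ≢ z → y ≢ z → ⊥) → count ≤ 2
  count≤2 no-three = subst (_≤ 2) length-witnesses (length≤2 witnesses-unique (all-filter P? (allFin k)))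
    where
    length≤2 : ∀ {xs} → Unique xs → All P xs → length xs ≤ 2
    length≤2 {[]}            _ _ = z≤n
    length≤2 {_ ∷ []}        _ _ = s≤s z≤n
    length≤2 {_ ∷ _ ∷ []}    _ _ = s≤s (s≤s z≤n)
    length≤2 {_ ∷ _ ∷ _ ∷ _} ((x≢y ∷ x≢z ∷ _) ∷ (y≢z ∷ _) ∷ _) (Px ∷ Py ∷ Pz ∷ _) =
      contradiction (no-three Px Py Pz x≢y x≢z y≢z) λ ()

  count-none : (∀ x → ¬ P x) → count ≡ 0
  count-none ¬P = trans (sum-cong-≗ indicator≡0) (sum-replicate-zero k)
    where
    indicator≡0 : ∀ x → χ x ≡ 0
    indicator≡0 x with P? x
    ... | yes Px = contradiction Px (¬P x)
    ... | no  _  = refl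

module _ {k : ℕ} {ℓ₁ ℓ₂} {P : Pred (Fin k) ℓ₁} {Q : Pred (Fin k) ℓ₂}
         (P? : Decidable P) (Q? : Decidable Q) where

  count-mono : (∀ {x} → P x → Q x) → count P? ≤ count Q?
  count-mono P⊆Q = ∑-mono-≤ indicator-mono
    where
    indicator-mono : ∀ x → χ P? x ≤ χ Q? x
    indicator-mono x with P? x | Q? x
    ... | yes Px | no ¬Qx = contradiction (P⊆Q Px) ¬Qx
    ... | yes _  | yes _  = ≤-refl
    ... | no _   | _      = z≤n

  count-∪ : count (P? ∪? Q?) ≤ count P? + count Q?
  count-∪ = begin
    count (P? ∪? Q?)              ≤⟨ ∑-mono-≤ indicator-∪ ⟩
    ∑[ i < k ] (χ P? i + χ Q? i)  ≡⟨ ∑-distrib-+ (χ P?) (χ Q?) ⟩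
    count P? + count Q?           ∎
    where
    open ≤-Reasoning
    indicator-∪ : ∀ x → χ (P? ∪? Q?) x ≤ χ P? x + χ Q? x
    indicator-∪ x with P? x | Q? x
    ... | yes _ | _     = s≤s z≤n
    ... | no _  | yes _ = ≤-refl
    ... | no _  | no _  = z≤n

count-all : ∀ {k} {P : Pred (Fin k) ℓ} (P? : Decidable P) → (∀ x → P x) → count P? ≡ k
count-all {k = k} P? all-P = trans (sum-cong-≗ indicator≡1) (trans (∑-const k 1) (*-identityʳ k))
  where
  indicator≡1 : ∀ x → χ P? x ≡ 1
  indicator≡1 x with P? x
  ... | yes _   = refl
  ... | no ¬Px = contradiction (all-P x) ¬Px

count-singleton : ∀ {k} {P : Pred (Fin k) ℓ} (P? : Decidable P) {x} → P x → (∀ {y} → P y → y ≡ x) →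
                  count P? ≡ 1
count-singleton P? Px only-x = ≤-antisym (count≤1 P? λ Py Pz → trans (only-x Py) (sym (only-x Pz)))
                                         (count>0 P? Px)

count-fibres : ∀ {k l} {P : Pred (Fin k) ℓ} (P? : Decidable P) (f : Fin k → Fin l) →
               count P? ≡ ∑[ w < l ] count (P? ∩? ((_≟ w) ∘ f))
count-fibres {k = k} {l} P? f = trans (sum-cong-≗ indicator≡fibre-count)
  (∑-comm {k} {l} λ x w → χ (λ e → P? e ×-dec (f e ≟ w)) x)
  where
  indicator≡fibre-count : ∀ x → χ P? x ≡ count (λ w → P? x ×-dec (f x ≟ w))
  indicator≡fibre-count x with P? x
  ... | yes _ = sym (count-singleton (f x ≟_) refl sym)
  ... | no _  = sym (sum-replicate-zero l)

count-∁ : ∀ {k} {P : Pred (Fin k) ℓ} (P? : Decidable P) → count P? + count (∁? P?) ≡ k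
count-∁ {k = k} P? = begin
  count P? + count (∁? P?)          ≡⟨ ∑-distrib-+ (χ P?) (χ (∁? P?)) ⟨
  ∑[ i < k ] (χ P? i + χ (∁? P?) i) ≡⟨ sum-cong-≗ χ+χ∁≡1 ⟩
  ∑[ i < k ] 1                      ≡⟨ ∑-const k 1 ⟩
  k * 1                             ≡⟨ *-identityʳ k ⟩
  k                                 ∎
  where
  open ≡-Reasoning
  χ+χ∁≡1 : ∀ x → χ P? x + χ (∁? P?) x ≡ 1
  χ+χ∁≡1 x with P? x
  ... | yes _ = refl
  ... | no _  = refl

∣p∣≡count : ∀ {k} (p : Subset k) → ∣ p ∣ ≡ count (_∈? p)
∣p∣≡count []          = refl
∣p∣≡count (true ∷ p)  = cong suc (∣p∣≡count p)
∣p∣≡count (false ∷ p) = ∣p∣≡count p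

-- Paths and in-degrees

module _ {n m : ℕ} {G : RootedGraph n m} {S : Subset m} where
  open RootedGraph G

  visits : ∀ {u v} → Path G S u v → List (Fin n)
  visits here           = []
  visits (step e p _ _) = tgt e ∷ visits p

  ∈-visits : ∀ {u v} (p : Path G S u v) → v ≢ u → v ∈ₗ visits p
  ∈-visits here           v≢u = contradiction refl v≢u
  ∈-visits (step _ _ _ _) _   = here refl

  ∈-visits⇒Path : ∀ {u v w} (p : Path G S u v) → w ∈ₗ visits p → Path G S w v
  ∈-visits⇒Path (step e p e∈S refl) (here refl)  = here
  ∈-visits⇒Path (step e p e∈S refl) (there w∈vp) = step e (∈-visits⇒Path p w∈vp) e∈S refl

  last-edge : ∀ {u v} → Path G S u v → v ≢ u → ∃ λ e → e ∈ S × tgt e ≡ v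
  last-edge here             v≢u = contradiction refl v≢u
  last-edge (step e _ e∈S _) _   = e , e∈S , refl

module _ {n m : ℕ} (G : RootedGraph n m) where
  open RootedGraph G

  nonRoot? : Decidable (_≢ root)
  nonRoot? v = ¬? (v ≟ root)

  count-nonRoot : count nonRoot? ≡ n ∸ 1
  count-nonRoot = begin
    count nonRoot?                        ≡⟨ m+n∸m≡n 1 (count nonRoot?) ⟨
    1 + count nonRoot? ∸ 1                ≡⟨ cong (λ c → c + count nonRoot? ∸ 1) count-root ⟨
    count (_≟ root) + count nonRoot? ∸ 1  ≡⟨ cong (_∸ 1) (count-∁ (_≟ root)) ⟩
    n ∸ 1                                 ∎
    where
    open ≡-Reasoning
    count-root : count (_≟ root) ≡ 1
    count-root = count-singleton (_≟ root) refl id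

  χ-nonRoot-root : χ nonRoot? root ≡ 0
  χ-nonRoot-root with root ≟ root
  ... | yes _      = refl
  ... | no  r≢r    = contradiction refl r≢r

  entering? : {S : Pred (Fin m) ℓ} → Decidable S → (v : Fin n) → Decidable (λ e → S e × tgt e ≡ v)
  entering? S? v = S? ∩? ((_≟ v) ∘ tgt)

  indegree : {S : Pred (Fin m) ℓ} → Decidable S → Fin n → ℕ
  indegree S? v = count (entering? S? v)

  Fed : Pred (Fin m) ℓ → Set ℓ
  Fed S = ∀ v → v ≢ root → ∃ λ e → S e × tgt e ≡ v

  record UniqueParents (S : Pred (Fin m) ℓ) : Set ℓ where
    field
      root-parentless : ∀ {e} → S e → tgt e ≢ root
      parent-unique   : ∀ {e e′} → S e → S e′ → tgt e ≡ tgt e′ → e ≡ e′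

  module _ {S : Pred (Fin m) ℓ} (S? : Decidable S) where

    ∑-indegree : ∑[ v < n ] indegree S? v ≡ count S?
    ∑-indegree = sym (count-fibres S? tgt)

    fed⇒χ≤indegree : Fed S → ∀ v → χ nonRoot? v ≤ indegree S? v
    fed⇒χ≤indegree fed v with v ≟ root
    ... | yes _      = z≤n
    ... | no v≢root  with fed v v≢root
    ...   | e , Se , te≡v = count>0 (entering? S? v) (Se , te≡v)

    uniqueParents⇒indegree≤χ : UniqueParents S → ∀ v → indegree S? v ≤ χ nonRoot? v
    uniqueParents⇒indegree≤χ up v with v ≟ root
    ... | yes refl = ≤-reflexive (count-none (entering? S? root) λ _ (Se , te≡root) → root-parentless Se te≡root)
      where open UniqueParents up
    ... | no _     = count≤1 (entering? S? v)
                       λ (Se , te≡v) (Se′ , te′≡v) → parent-unique Se Se′ (trans te≡v (sym te′≡v))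
      where open UniqueParents up

    indegree≤χ⇒uniqueParents : (∀ v → indegree S? v ≤ χ nonRoot? v) → UniqueParents S
    indegree≤χ⇒uniqueParents indegree≤χ = record
      { root-parentless = λ Se te≡root →
          <⇒≱ (count>0 (entering? S? root) (Se , te≡root))
              (≤-trans (indegree≤χ root) (≤-reflexive χ-nonRoot-root))
      ; parent-unique   = parent-unique
      }
      where
      parent-unique : ∀ {e e′} → S e → S e′ → tgt e ≡ tgt e′ → e ≡ e′
      parent-unique {e} {e′} Se Se′ te≡te′ with e ≟ e′
      ... | yes e≡e′ = e≡e′
      ... | no  e≢e′ = contradiction (≤-trans (indegree≤χ (tgt e)) (χ≤1 nonRoot? (tgt e)))
                                     (<⇒≱ (count≥2 (entering? S? (tgt e)) (Se , refl) (Se′ , sym te≡te′) e≢e′))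

    fed∧uniqueParents⇒count : Fed S → UniqueParents S → count S? ≡ n ∸ 1
    fed∧uniqueParents⇒count fed up = begin
      count S?                 ≡⟨ ∑-indegree ⟨
      ∑[ v < n ] indegree S? v ≡⟨ sum-cong-≗ indegree≡χ ⟩
      count nonRoot?           ≡⟨ count-nonRoot ⟩
      n ∸ 1                    ∎
      where
      open ≡-Reasoning
      indegree≡χ : ∀ v → indegree S? v ≡ χ nonRoot? v
      indegree≡χ v = ≤-antisym (uniqueParents⇒indegree≤χ up v) (fed⇒χ≤indegree fed v)

  arborescence⇒uniqueParents : ∀ {T} → IsArborescence G T → UniqueParents (_∈ T)
  arborescence⇒uniqueParents {T} (∣T∣≡n∸1 , reach) =
    indegree≤χ⇒uniqueParents (_∈? T)
      (∑-tight (fed⇒χ≤indegree (_∈? T) fed) (≤-reflexive ∑indegree≡∑χ))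
    where
    fed : Fed (_∈ T)
    fed v = last-edge (reach v)
    ∑indegree≡∑χ : ∑[ v < n ] indegree (_∈? T) v ≡ count nonRoot?
    ∑indegree≡∑χ = begin
      ∑[ v < n ] indegree (_∈? T) v   ≡⟨ ∑-indegree (_∈? T) ⟩
      count (_∈? T)                   ≡⟨ ∣p∣≡count T ⟨
      ∣ T ∣                           ≡⟨ ∣T∣≡n∸1 ⟩
      n ∸ 1                           ≡⟨ count-nonRoot ⟨
      count nonRoot?                  ∎
      where open ≡-Reasoning

  Arc : Pred (Fin m) ℓ → Rel (Fin n) ℓ
  Arc S u v = ∃ λ e → S e × src e ≡ u × tgt e ≡ v

  record SpanningDAG : Set₁ where
    field
      Edge            : Pred (Fin m) 0ℓ
      edge?           : Decidable Edge
      acyclic         : WellFounded (Arc Edge)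
      root-parentless : ∀ {e} → Edge e → tgt e ≢ root
      fed             : Fed Edge

-- Lexicographic orders of root paths

module _ {a} {A : Set a} {_≺_ : Rel A ℓ} where

  Lex-<-++ : ∀ xs {y ys} → Lex-< _≡_ _≺_ xs (xs ++ y ∷ ys)
  Lex-<-++ []       = halt
  Lex-<-++ (x ∷ xs) = next refl (Lex-<-++ xs)

  lex-or-prefix : Trichotomous _≡_ _≺_ → ∀ xs ys →
                  Lex-< _≡_ _≺_ xs ys ⊎ Lex-< _≡_ (flip _≺_) xs ys ⊎ ∃ λ zs → xs ≡ ys ++ zs
  lex-or-prefix compare []       []       = inj₂ (inj₂ ([] , refl))
  lex-or-prefix compare []       (y ∷ ys) = inj₁ halt
  lex-or-prefix compare (x ∷ xs) []       = inj₂ (inj₂ (x ∷ xs , refl))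
  lex-or-prefix compare (x ∷ xs) (y ∷ ys) with compare x y
  ... | tri< x≺y _ _ = inj₁ (this x≺y)
  ... | tri> _ _ y≺x = inj₂ (inj₁ (this y≺x))
  ... | tri≈ _ refl _ with lex-or-prefix compare xs ys
  ...   | inj₁ xs<ys           = inj₁ (next refl xs<ys)
  ...   | inj₂ (inj₁ xs>ys)    = inj₂ (inj₁ (next refl xs>ys))
  ...   | inj₂ (inj₂ (zs , p)) = inj₂ (inj₂ (zs , cong (x ∷_) p))

module Arborescence {n m : ℕ} (G : RootedGraph n m) {T : Subset m} (arb : IsArborescence G T) where
  open RootedGraph G
  open UniqueParents (arborescence⇒uniqueParents G arb)

  pathFromRoot : ∀ v → Path G T root v
  pathFromRoot = proj₂ arb

  visits-unique : ∀ {v w} (p : Path G T root v) (q : Path G T root w) → v ≡ w → visits p ≡ visits q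
  visits-unique here               here               _       = refl
  visits-unique here               (step e _ e∈T _)   r≡te    = contradiction (sym r≡te) (root-parentless e∈T)
  visits-unique (step e _ e∈T _)   here               te≡r    = contradiction te≡r (root-parentless e∈T)
  visits-unique (step e p e∈T refl) (step e′ q e′∈T refl) te≡te′ with parent-unique e∈T e′∈T te≡te′
  ... | refl = cong (tgt e ∷_) (visits-unique p q refl)

  key : Fin n → List (Fin n)
  key v = reverse (visits (pathFromRoot v))

  key-root : key root ≡ []
  key-root = cong reverse (visits-unique (pathFromRoot root) here refl)

  key-parent : ∀ {e} → e ∈ T → key (tgt e) ≡ key (src e) ∷ʳ tgt e
  key-parent {e} e∈T = begin
    reverse (visits (pathFromRoot (tgt e)))  ≡⟨ cong reverse (visits-unique (pathFromRoot (tgt e)) via-e refl) ⟩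
    reverse (visits via-e)                   ≡⟨ unfold-reverse (tgt e) (visits (pathFromRoot (src e))) ⟩
    key (src e) ∷ʳ tgt e                     ∎
    where
    open ≡-Reasoning
    via-e : Path G T root (tgt e)
    via-e = step e (pathFromRoot (src e)) e∈T refl

  key-prefix⇒ancestor : ∀ {u v} zs → key u ≡ key v ++ zs → Ancestor G T v u
  key-prefix⇒ancestor {u} {v} zs ku≡kv++zs with v ≟ root
  ... | yes refl    = pathFromRoot u
  ... | no v≢root   = ∈-visits⇒Path (pathFromRoot u) (reverse⁻ v∈key-u)
    where
    v∈key-u : v ∈ₗ key u
    v∈key-u = subst (v ∈ₗ_) (sym ku≡kv++zs) (∈-++⁺ˡ (reverse⁺ (∈-visits (pathFromRoot v) v≢root)))

  Forward : Rel (Fin n) 0ℓ → Pred (Fin m) 0ℓ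
  Forward _≺_ e = Lex-< _≡_ _≺_ (key (src e)) (key (tgt e))

  nonAncestor⇒forward : ∀ {_≺_ : Rel (Fin n) 0ℓ} → Trichotomous _≡_ _≺_ →
                        ∀ e → ¬ Ancestor G T (tgt e) (src e) → Forward _≺_ e ⊎ Forward (flip _≺_) e
  nonAncestor⇒forward compare e ¬anc with lex-or-prefix compare (key (src e)) (key (tgt e))
  ... | inj₁ fwd              = inj₁ fwd
  ... | inj₂ (inj₁ fwd)       = inj₂ fwd
  ... | inj₂ (inj₂ (zs , eq)) = contradiction (key-prefix⇒ancestor zs eq) ¬anc

  forwardDAG : ∀ {_≺_ : Rel (Fin n) 0ℓ} → IsStrictTotalOrder _≡_ _≺_ → SpanningDAG G
  forwardDAG {_≺_} ≺-sto = record
    { Edge            = Forward _≺_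
    ; edge?           = λ e → Lex.<-decidable _≟_ _≺?_ (key (src e)) (key (tgt e))
    ; acyclic         = Subrelation.wellFounded arc⇒key<
                          (spo-wellFounded (On.isStrictPartialOrder key (Lex.<-isStrictPartialOrder isStrictPartialOrder)))
    ; root-parentless = λ fwd te≡r → Lex.xs≮[] (subst (Lex-< _≡_ _≺_ _) (trans (cong key te≡r) key-root) fwd)
    ; fed             = fed
    }
    where
    open IsStrictTotalOrder ≺-sto using (isStrictPartialOrder) renaming (_<?_ to _≺?_)
    arc⇒key< : ∀ {u v} → Arc G (Forward _≺_) u v → Lex-< _≡_ _≺_ (key u) (key v)
    arc⇒key< (e , fwd , refl , refl) = fwd
    fed : Fed G (Forward _≺_)
    fed v v≢root with last-edge (pathFromRoot v) v≢root
    ... | e , e∈T , te≡v = e , parent-forward , te≡v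
      where
      parent-forward : Forward _≺_ e
      parent-forward = subst (Lex-< _≡_ _≺_ (key (src e))) (sym (key-parent e∈T)) (Lex-<-++ (key (src e)))

-- Choosing one in-edge per node

module Selections {n m : ℕ} {G : RootedGraph n m} (D : SpanningDAG G) where
  open RootedGraph G
  open SpanningDAG D using (Edge; edge?; acyclic; root-parentless; fed)

  inEdges : Fin n → List (Fin m)
  inEdges w = witnesses (entering? G edge? w)

  addEdge : Fin m × Subset m → Subset m
  addEdge (e , X) = ⁅ e ⁆ ∪ X

  extend : Fin n → List (Subset m) → List (Subset m)
  extend w Xs with w ≟ root
  ... | yes _ = Xs
  ... | no  _ = map addEdge (cartesianProduct (inEdges w) Xs)

  selections : List (Fin n) → List (Subset m)
  selections = foldr extend (∅ ∷ [])

  fanIn : Fin n → ℕ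
  fanIn w with w ≟ root
  ... | yes _ = 1
  ... | no  _ = indegree G edge? w

  length-selections : ∀ ws → length (selections ws) ≡ product (map fanIn ws)
  length-selections []       = refl
  length-selections (w ∷ ws) with w ≟ root
  ... | yes _ = trans (length-selections ws) (sym (+-identityʳ _))
  ... | no  _ = begin
    length (map addEdge choices)                 ≡⟨ length-map addEdge choices ⟩
    length choices                               ≡⟨ length-cartesianProduct (inEdges w) (selections ws) ⟩
    length (inEdges w) * length (selections ws)  ≡⟨ cong₂ _*_ (length-witnesses (entering? G edge? w))
                                                              (length-selections ws) ⟩
    indegree G edge? w * product (map fanIn ws)  ∎
    where
    open ≡-Reasoning
    choices : List (Fin m × Subset m)
    choices = cartesianProduct (inEdges w) (selections ws)

  fanIn-pos : ∀ w → 1 ≤ fanIn w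
  fanIn-pos w with w ≟ root
  ... | yes _     = ≤-refl
  ... | no w≢root = count>0 (entering? G edge? w) (proj₂ (fed w w≢root))

  indegree≤fanIn : ∀ w → indegree G edge? w ≤ fanIn w
  indegree≤fanIn w with w ≟ root
  ... | yes refl = ≤-trans (≤-reflexive (count-none (entering? G edge? root) λ _ (Fe , te≡r) → root-parentless Fe te≡r))
                           z≤n
  ... | no  _    = ≤-refl

  excess : Fin n → ℕ
  excess w = fanIn w ∸ 1

  excesses : List ℕ
  excesses = map excess (allFin n)

  product[1+excesses] : product (map suc excesses) ≡ product (map fanIn (allFin n))
  product[1+excesses] = cong product
    (trans (sym (map-∘ (allFin n))) (map-cong (λ w → m+[n∸m]≡n (fanIn-pos w)) (allFin n)))

  count≤n+sum-excesses : count edge? ≤ n + sum excesses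
  count≤n+sum-excesses = begin
    count edge?                         ≡⟨ ∑-indegree G edge? ⟨
    ∑[ w < n ] indegree G edge? w       ≤⟨ ∑-mono-≤ indegree≤fanIn ⟩
    ∑[ w < n ] fanIn w                  ≡⟨ sum-cong-≗ (λ w → sym (m+[n∸m]≡n (fanIn-pos w))) ⟩
    ∑[ w < n ] (1 + excess w)           ≡⟨ ∑-distrib-+ (λ _ → 1) excess ⟩
    ∑[ w < n ] 1 + ∑[ w < n ] excess w  ≡⟨ cong₂ _+_ (trans (∑-const n 1) (*-identityʳ n)) (sym sum-excesses) ⟩
    n + sum excesses                    ∎
    where
    open ≤-Reasoning
    sum-excesses : sum excesses ≡ ∑[ w < n ] excess w
    sum-excesses = trans (cong sum (map-tabulate id excess)) (sum-tabulate excess)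

  record Selects (ws : List (Fin n)) (X : Subset m) : Set where
    field
      selected   : ∀ {e} → e ∈ X → Edge e × tgt e ∈ₗ ws
      complete   : ∀ {w} → w ∈ₗ ws → w ≢ root → ∃ λ e → e ∈ X × tgt e ≡ w
      functional : ∀ {e e′} → e ∈ X → e′ ∈ X → tgt e ≡ tgt e′ → e ≡ e′

    ∉-selected : ∀ {e} → tgt e ∉ₗ ws → e ∉ X
    ∉-selected te∉ws e∈X = te∉ws (proj₂ (selected e∈X))

  open Selects

  selects-∅ : Selects [] ∅
  selects-∅ = record
    { selected   = λ e∈∅ → contradiction e∈∅ ∉⊥
    ; complete   = λ ()
    ; functional = λ e∈∅ → contradiction e∈∅ ∉⊥
    }

  selects-root : ∀ {w ws X} → w ≡ root → Selects ws X → Selects (w ∷ ws) X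
  selects-root w≡root sel = record
    { selected   = λ e∈X → let (fwd , te∈ws) = selected sel e∈X in fwd , there te∈ws
    ; complete   = λ { (here refl) w≢root → contradiction w≡root w≢root
                     ; (there v∈ws) → complete sel v∈ws }
    ; functional = functional sel
    }

  selects-addEdge : ∀ {w ws e X} → w ∉ₗ ws → Edge e → tgt e ≡ w → Selects ws X →
                    Selects (w ∷ ws) (addEdge (e , X))
  selects-addEdge {w} {ws} {e} {X} w∉ws Fe te≡w sel = record
    { selected   = selected′
    ; complete   = complete′
    ; functional = functional′
    }
    where
    cases : ∀ {x} → x ∈ addEdge (e , X) → x ≡ e ⊎ x ∈ X
    cases {x} x∈ with x∈p∪q⁻ ⁅ e ⁆ X x∈
    ... | inj₁ x∈⁅e⁆ = inj₁ (x∈⁅y⁆⇒x≡y e x∈⁅e⁆)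
    ... | inj₂ x∈X   = inj₂ x∈X
    into-w∉X : ∀ {x} → tgt x ≡ w → x ∉ X
    into-w∉X tx≡w = ∉-selected sel (λ tx∈ws → w∉ws (subst (_∈ₗ ws) tx≡w tx∈ws))
    selected′ : ∀ {x} → x ∈ addEdge (e , X) → Edge x × tgt x ∈ₗ w ∷ ws
    selected′ x∈ with cases x∈
    ... | inj₁ refl = Fe , here te≡w
    ... | inj₂ x∈X  = let (fwd , tx∈ws) = selected sel x∈X in fwd , there tx∈ws
    complete′ : ∀ {v} → v ∈ₗ w ∷ ws → v ≢ root → ∃ λ x → x ∈ addEdge (e , X) × tgt x ≡ v
    complete′ (here refl) _ = e , x∈p∪q⁺ (inj₁ (x∈⁅x⁆ e)) , te≡w
    complete′ (there v∈ws) v≢root with complete sel v∈ws v≢root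
    ... | x , x∈X , tx≡v = x , x∈p∪q⁺ (inj₂ x∈X) , tx≡v
    functional′ : ∀ {x y} → x ∈ addEdge (e , X) → y ∈ addEdge (e , X) → tgt x ≡ tgt y → x ≡ y
    functional′ x∈ y∈ tx≡ty with cases x∈ | cases y∈
    ... | inj₁ refl | inj₁ refl = refl
    ... | inj₁ refl | inj₂ y∈X  = contradiction y∈X (into-w∉X (trans (sym tx≡ty) te≡w))
    ... | inj₂ x∈X  | inj₁ refl = contradiction x∈X (into-w∉X (trans tx≡ty te≡w))
    ... | inj₂ x∈X  | inj₂ y∈X  = functional sel x∈X y∈X tx≡ty

  selections-sound : ∀ {ws} → Unique ws → ∀ {X} → X ∈ₗ selections ws → Selects ws X
  selections-sound {[]}     _            (here refl) = selects-∅
  selections-sound {w ∷ ws} (w∉ws ∷ uws) X∈ with w ≟ root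
  ... | yes w≡root = selects-root w≡root (selections-sound uws X∈)
  ... | no  _      with ∈-map⁻ addEdge X∈
  ...   | (e , X) , eX∈ , refl with ∈-cartesianProduct⁻ (inEdges w) (selections ws) eX∈
  ...     | e∈inEdges , X∈ with ∈-witnesses⁻ (entering? G edge? w) e∈inEdges
  ...       | Fe , te≡w =
    selects-addEdge (λ w∈ws → All.lookup w∉ws w∈ws refl) Fe te≡w (selections-sound uws X∈)

  selections-unique : ∀ {ws} → Unique ws → Unique (selections ws)
  selections-unique {[]}     _            = [] ∷ []
  selections-unique {w ∷ ws} (w∉ws ∷ uws) with w ≟ root
  ... | yes _ = selections-unique uws
  ... | no  _ = unique-map⁺ addEdge-injective
                  (Unique.cartesianProduct⁺ (witnesses-unique (entering? G edge? w)) (selections-unique uws))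
    where
    into-w∉ : ∀ {e X} → e ∈ₗ inEdges w → X ∈ₗ selections ws → e ∉ X
    into-w∉ e∈inEdges X∈ = ∉-selected (selections-sound uws X∈) λ te∈ws →
      All.lookup w∉ws (subst (_∈ₗ ws) (proj₂ (∈-witnesses⁻ (entering? G edge? w) e∈inEdges)) te∈ws) refl
    addEdge-injective : ∀ {p q} → p ∈ₗ cartesianProduct (inEdges w) (selections ws) →
                        q ∈ₗ cartesianProduct (inEdges w) (selections ws) → addEdge p ≡ addEdge q → p ≡ q
    addEdge-injective {e , X} {e′ , X′} p∈ q∈ eq
      with ∈-cartesianProduct⁻ (inEdges w) (selections ws) p∈
         | ∈-cartesianProduct⁻ (inEdges w) (selections ws) q∈
    ... | e∈ , X∈ | e′∈ , X′∈ with ⁅⁆∪-injective (into-w∉ e∈ X′∈) (into-w∉ e′∈ X∈) eq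
    ...   | refl , refl = refl

  selection⇒arborescence : ∀ {X} → Selects (allFin n) X → IsArborescence G X
  selection⇒arborescence {X} sel = size , λ v → reach (acyclic v)
    where
    X-fed : Fed G (_∈ X)
    X-fed v = complete sel (∈-allFin v)
    X-parents : UniqueParents G (_∈ X)
    X-parents = record
      { root-parentless = λ e∈X → root-parentless (proj₁ (selected sel e∈X))
      ; parent-unique   = functional sel
      }
    size : ∣ X ∣ ≡ n ∸ 1
    size = trans (∣p∣≡count X) (fed∧uniqueParents⇒count G (_∈? X) X-fed X-parents)
    reach : ∀ {v} → Acc (Arc G Edge) v → Path G X root v
    reach {v} (acc rs) with v ≟ root
    ... | yes refl    = here
    ... | no v≢root with X-fed v v≢root
    ...   | e , e∈X , refl = step e (reach (rs (e , proj₁ (selected sel e∈X) , refl , refl))) e∈X refl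

  product-fanIn≤ : (L : List (Subset m)) → (∀ X → IsArborescence G X → X ∈ₗ L) →
                   product (map fanIn (allFin n)) ≤ length L
  product-fanIn≤ L complete-L = begin
    product (map fanIn (allFin n))  ≡⟨ length-selections (allFin n) ⟨
    length (selections (allFin n))  ≤⟨ unique-⊆⇒length≤ (selections-unique allFin-unique) selections⊆L ⟩
    length L                        ∎
    where
    open ≤-Reasoning
    allFin-unique : Unique (allFin n)
    allFin-unique = Unique.allFin⁺ n
    selections⊆L : ∀ {X} → X ∈ₗ selections (allFin n) → X ∈ₗ L
    selections⊆L X∈ = complete-L _ (selection⇒arborescence (selections-sound allFin-unique X∈))

1+[a+b]≤[1+a]*[1+b] : ∀ a b → 1 + (a + b) ≤ (1 + a) * (1 + b)
1+[a+b]≤[1+a]*[1+b] a b = begin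
  1 + (a + b)            ≡⟨ cong suc (+-comm a b) ⟩
  1 + (b + a)            ≤⟨ s≤s (+-monoʳ-≤ b (m≤m*n a (1 + b))) ⟩
  1 + (b + a * (1 + b))  ∎
  where open ≤-Reasoning

[1+[a+b]]*c≤[1+a]*[[1+b]*c] : ∀ a b c → (1 + (a + b)) * c ≤ (1 + a) * ((1 + b) * c)
[1+[a+b]]*c≤[1+a]*[[1+b]*c] a b c =
  ≤-trans (*-monoˡ-≤ c (1+[a+b]≤[1+a]*[1+b] a b)) (≤-reflexive (*-assoc (1 + a) (1 + b) c))

1≤product[1+gs] : ∀ gs → 1 ≤ product (map suc gs)
1≤product[1+gs] []       = ≤-refl
1≤product[1+gs] (g ∷ gs) = *-mono-≤ (s≤s (z≤n {g})) (1≤product[1+gs] gs)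

-- Cut gs greedily into consecutive blocks whose sums lie in [M, 2M], the accumulator a being the sum
-- of the current unfinished block; each finished block contributes a factor ≥ 1 + M.
[1+M]^j≤[1+a]*product[1+gs] : ∀ M a j gs → a < M → All (_≤ M) gs → j * (2 * M) ≤ a + sum gs →
                              (1 + M) ^ j ≤ (1 + a) * product (map suc gs)
[1+M]^j≤[1+a]*product[1+gs] M a zero    gs       _   _ _ = ≤-trans (1≤product[1+gs] gs) (m≤n*m _ (1 + a))
[1+M]^j≤[1+a]*product[1+gs] M a (suc j) []       a<M _ h =
  contradiction (≤-trans (m≤m+n (2 * M) (j * (2 * M))) (≤-trans h (≤-reflexive (+-identityʳ a))))
                (<⇒≱ (<-≤-trans a<M (m≤m+n M (M + 0))))
[1+M]^j≤[1+a]*product[1+gs] M a (suc j) (g ∷ gs) a<M (g≤M ∷ gs≤M) h with a + g <? M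
... | yes a+g<M = begin
  (1 + M) ^ suc j          ≤⟨ [1+M]^j≤[1+a]*product[1+gs] M (a + g) (suc j) gs a+g<M gs≤M h′ ⟩
  (1 + (a + g)) * P        ≤⟨ [1+[a+b]]*c≤[1+a]*[[1+b]*c] a g P ⟩
  (1 + a) * ((1 + g) * P)  ∎
  where
  open ≤-Reasoning
  P : ℕ
  P = product (map suc gs)
  h′ : suc j * (2 * M) ≤ (a + g) + sum gs
  h′ = subst (suc j * (2 * M) ≤_) (sym (+-assoc a g (sum gs))) h
... | no  a+g≮M = begin
  (1 + M) * (1 + M) ^ j    ≤⟨ *-monoʳ-≤ (1 + M)
                                ([1+M]^j≤[1+a]*product[1+gs] M 0 j gs (≤-<-trans z≤n a<M) gs≤M h′) ⟩
  (1 + M) * (1 * P)        ≡⟨ cong ((1 + M) *_) (*-identityˡ P) ⟩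
  (1 + M) * P              ≤⟨ *-monoˡ-≤ P (s≤s (≮⇒≥ a+g≮M)) ⟩
  (1 + (a + g)) * P        ≤⟨ [1+[a+b]]*c≤[1+a]*[[1+b]*c] a g P ⟩
  (1 + a) * ((1 + g) * P)  ∎
  where
  open ≤-Reasoning
  P : ℕ
  P = product (map suc gs)
  a+g≤2M : a + g ≤ 2 * M
  a+g≤2M = +-mono-≤ (<⇒≤ a<M) (≤-trans g≤M (≤-reflexive (sym (+-identityʳ M))))
  h′ : j * (2 * M) ≤ 0 + sum gs
  h′ = +-cancelˡ-≤ (2 * M) _ _ (begin
    2 * M + j * (2 * M)  ≤⟨ h ⟩
    a + (g + sum gs)     ≡⟨ +-assoc a g (sum gs) ⟨
    a + g + sum gs       ≤⟨ +-monoˡ-≤ (sum gs) a+g≤2M ⟩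
    2 * M + sum gs       ∎)

[1+M]^j≤product[1+gs] : ∀ {M} j gs → 0 < M → All (_≤ M) gs → j * (2 * M) ≤ sum gs →
                        (1 + M) ^ j ≤ product (map suc gs)
[1+M]^j≤product[1+gs] {M} j gs 0<M gs≤M h =
  subst ((1 + M) ^ j ≤_) (+-identityʳ (product (map suc gs))) ([1+M]^j≤[1+a]*product[1+gs] M 0 j gs 0<M gs≤M h)

m≤n*2n⇒m^4≤[1+2n]^8 : ∀ {m n} → m ≤ n * (2 * n) → m ^ 4 ≤ (1 + 2 * n) ^ 8
m≤n*2n⇒m^4≤[1+2n]^8 {m} {n} m≤n*2n = begin
  m ^ 4                               ≤⟨ ^-monoˡ-≤ 4 (≤-trans m≤n*2n (*-mono-≤ n≤1+2n (n≤1+n (2 * n)))) ⟩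
  ((1 + 2 * n) * (1 + 2 * n)) ^ 4     ≡⟨ cong (λ x → ((1 + 2 * n) * x) ^ 4) (*-identityʳ (1 + 2 * n)) ⟨
  ((1 + 2 * n) ^ 2) ^ 4               ≡⟨ ^-*-assoc (1 + 2 * n) 2 4 ⟩
  (1 + 2 * n) ^ 8                     ∎
  where
  open ≤-Reasoning
  n≤1+2n : n ≤ 1 + 2 * n
  n≤1+2n = ≤-trans (m≤m+n n (n + 0)) (n≤1+n (2 * n))

-- Flat graphs with few arborescences

module _ {n m : ℕ} (G : RootedGraph n m) (flat : Flat G) where
  open RootedGraph G

  indegree≤2n : ∀ {S : Pred (Fin m) ℓ} (S? : Decidable S) v → indegree G S? v ≤ 2 * n
  indegree≤2n S? v = begin
    indegree G S? v                        ≤⟨ count-mono (entering? G S? v) (entering? G U? v)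
                                                         (λ (_ , te≡v) → tt , te≡v) ⟩
    indegree G U? v                        ≡⟨ count-fibres (entering? G U? v) src ⟩
    ∑[ u < n ] count (parallel? u)         ≤⟨ ∑-mono-≤ (λ u → count≤2 (parallel? u) no-three-parallel) ⟩
    ∑[ u < n ] 2                           ≡⟨ ∑-const n 2 ⟩
    n * 2                                  ≡⟨ *-comm n 2 ⟩
    2 * n                                  ∎
    where
    open ≤-Reasoning
    parallel? : ∀ u → Decidable (λ e → (U e × tgt e ≡ v) × src e ≡ u)
    parallel? u = entering? G U? v ∩? ((_≟ u) ∘ src)
    no-three-parallel : ∀ {u x y z} → (U x × tgt x ≡ v) × src x ≡ u → (U y × tgt y ≡ v) × src y ≡ u →
                        (U z × tgt z ≡ v) × src z ≡ u → x ≢ y → x ≢ z → y ≢ z → ⊥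
    no-three-parallel ((_ , tx) , sx) ((_ , ty) , sy) ((_ , tz) , sz) =
      flat _ _ _ (trans sx (sym sy)) (trans tx (sym ty)) (trans sx (sym sz)) (trans tx (sym tz))

  m≤n*2n : m ≤ n * (2 * n)
  m≤n*2n = begin
    m                              ≡⟨ count-all (U? {A = Fin m}) (λ _ → tt) ⟨
    count (U? {A = Fin m})         ≡⟨ ∑-indegree G U? ⟨
    ∑[ v < n ] indegree G U? v     ≤⟨ ∑-mono-≤ (indegree≤2n U?) ⟩
    ∑[ v < n ] (2 * n)             ≡⟨ ∑-const n (2 * n) ⟩
    n * (2 * n)                    ∎
    where open ≤-Reasoning

module _ {n m : ℕ} {G : RootedGraph n m} (flat : Flat G) (few : FewerArborescencesThan G (m ^ 4)) where
  open RootedGraph G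

  -- Beyond 33n edges the excesses sum to at least 32n = 8 · (2 · 2n): eight blocks for M = 2n.
  spanningDAG-size≤33n : (D : SpanningDAG G) → count (SpanningDAG.edge? D) ≤ 33 * n
  spanningDAG-size≤33n D with count (SpanningDAG.edge? D) ≤? 33 * n
  ... | yes ≤33n = ≤33n
  ... | no  ≰33n = contradiction (begin-strict
    (1 + 2 * n) ^ 8                 ≤⟨ [1+M]^j≤product[1+gs] 8 excesses 0<2n excesses≤2n sum-excesses≥32n ⟩
    product (map suc excesses)      ≡⟨ product[1+excesses] ⟩
    product (map fanIn (allFin n))  ≤⟨ product-fanIn≤ L L-complete ⟩
    length L                        <⟨ length-L<m^4 ⟩
    m ^ 4                           ≤⟨ m≤n*2n⇒m^4≤[1+2n]^8 {m} {n} (m≤n*2n G flat) ⟩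
    (1 + 2 * n) ^ 8                 ∎) (<-irrefl refl)
    where
    open SpanningDAG D using (edge?)
    open Selections D
    open ≤-Reasoning
    L : List (Subset m)
    L = proj₁ few
    L-complete : ∀ X → IsArborescence G X → X ∈ₗ L
    L-complete = proj₁ (proj₂ (proj₂ few))
    length-L<m^4 : length L < m ^ 4
    length-L<m^4 = proj₂ (proj₂ (proj₂ (proj₂ few)))
    0<2n : 0 < 2 * n
    0<2n = <-≤-trans (>-nonZero⁻¹ n {{nonZeroIndex root}}) (m≤n*m n 2)
    fanIn≤1+2n : ∀ w → fanIn w ≤ 1 + 2 * n
    fanIn≤1+2n w with w ≟ root
    ... | yes _ = s≤s z≤n
    ... | no  _ = ≤-trans (indegree≤2n G flat edge? w) (n≤1+n _)
    excesses≤2n : All (_≤ 2 * n) excesses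
    excesses≤2n = All-map⁺ (All.universal (λ w → ∸-monoˡ-≤ 1 (fanIn≤1+2n w)) (allFin n))
    sum-excesses≥32n : 8 * (2 * (2 * n)) ≤ sum excesses
    sum-excesses≥32n = +-cancelˡ-≤ n _ _ (begin
      n + 8 * (2 * (2 * n))  ≡⟨ cong (n +_) (trans (sym (*-assoc 8 2 (2 * n))) (sym (*-assoc 16 2 n))) ⟩
      33 * n                 <⟨ ≰⇒> ≰33n ⟩
      count edge?            ≤⟨ count≤n+sum-excesses ⟩
      n + sum excesses       ∎)

  edges≤132n : ∀ {A B} → IsArborescence G A → IsArborescence G B →
               (∀ e → ¬ Ancestor G A (tgt e) (src e) ⊎ ¬ Ancestor G B (tgt e) (src e)) → m ≤ 132 * n
  edges≤132n arbA arbB no-back-edge = begin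
    m                                                  ≡⟨ count-all (U? {A = Fin m}) (λ _ → tt) ⟨
    count (U? {A = Fin m})                             ≤⟨ count-mono U? forward-somewhere? covered ⟩
    count forward-somewhere?
      ≤⟨ ≤-trans (count-∪ (forward? A< ∪? forward? A>) (forward? B< ∪? forward? B>))
                 (+-mono-≤ (count-∪ (forward? A<) (forward? A>)) (count-∪ (forward? B<) (forward? B>))) ⟩
    (count (forward? A<) + count (forward? A>)) + (count (forward? B<) + count (forward? B>))
      ≤⟨ +-mono-≤ (+-mono-≤ (spanningDAG-size≤33n A<) (spanningDAG-size≤33n A>))
                  (+-mono-≤ (spanningDAG-size≤33n B<) (spanningDAG-size≤33n B>)) ⟩
    (33 * n + 33 * n) + (33 * n + 33 * n)              ≡⟨ cong₂ _+_ (*-distribʳ-+ n 33 33) (*-distribʳ-+ n 33 33) ⟨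
    66 * n + 66 * n                                    ≡⟨ *-distribʳ-+ n 66 66 ⟨
    132 * n                                            ∎
    where
    open ≤-Reasoning
    forward? : (D : SpanningDAG G) → Decidable (SpanningDAG.Edge D)
    forward? = SpanningDAG.edge?
    module TA = Arborescence G arbA
    module TB = Arborescence G arbB
    A< A> B< B> : SpanningDAG G
    A< = TA.forwardDAG Finₚ.<-isStrictTotalOrder
    A> = TA.forwardDAG (Flip.isStrictTotalOrder Finₚ.<-isStrictTotalOrder)
    B< = TB.forwardDAG Finₚ.<-isStrictTotalOrder
    B> = TB.forwardDAG (Flip.isStrictTotalOrder Finₚ.<-isStrictTotalOrder)
    forward-somewhere? : Decidable λ e → (TA.Forward Fin._<_ e ⊎ TA.Forward (flip Fin._<_) e)
                                       ⊎ (TB.Forward Fin._<_ e ⊎ TB.Forward (flip Fin._<_) e)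
    forward-somewhere? = (forward? A< ∪? forward? A>) ∪? (forward? B< ∪? forward? B>)
    covered : ∀ {e} → U e → (TA.Forward Fin._<_ e ⊎ TA.Forward (flip Fin._<_) e)
                          ⊎ (TB.Forward Fin._<_ e ⊎ TB.Forward (flip Fin._<_) e)
    covered {e} _ with no-back-edge e
    ... | inj₁ ¬ancA = inj₁ (TA.nonAncestor⇒forward Finₚ.<-cmp e ¬ancA)
    ... | inj₂ ¬ancB = inj₂ (TB.nonAncestor⇒forward Finₚ.<-cmp e ¬ancB)

lemma11 : Σ ℕ λ c →
    ∀ (n m : ℕ) (G : RootedGraph n m) →
    Trimmed G → Flat G → FewerArborescencesThan G (m ^ 4) →
    (A B : Subset m) → IsArborescence G A → IsArborescence G B →
    (∀ e → ¬ (e ∈ A × e ∈ B)) →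
    (∀ e → ¬ Ancestor G A (RootedGraph.tgt G e) (RootedGraph.src G e)
         ⊎ ¬ Ancestor G B (RootedGraph.tgt G e) (RootedGraph.src G e)) →
    ∣ ∁ (A ∪ B) ∣ ≤ c * n
lemma11 = 132 , λ n m G _ flat few A B arbA arbB _ no-back-edge →
  ≤-trans (∣p∣≤n (∁ (A ∪ B))) (edges≤132n flat few arbA arbB no-back-edge)
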